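{- Let $n\ge 1$ and let $\alpha=a_1\cdots a_{2n}$ and $\alpha'=b_1\cdots b_{2n}$ be consecutive strings (with $\alpha$ immediately before $\alpha'$) in the listing of $\mathbf{coN}(n)$ in reverse colexicographic order. Then $\text{pre}_n(\alpha)$ comes before $\text{pre}_n(\alpha')$ in colexicographic order.
   Context: Strings are binary, over $\{0,1\}$. For a binary string $\alpha$, $\overline{\alpha}$ is its bitwise complement. A necklace is a string that is lexicographically smallest among all its rotations. A binary string $\alpha$ of length $n$ is a co-necklace if $\alpha\overline{\alpha}$ is a necklace; $\mathbf{coN}(n)=\{\alpha\overline{\alpha}:\alpha \text{ a co-necklace of length } n\}$ (the extended co-necklaces). Colexicographic order on strings of equal length: $a_1\cdots a_\ell$ precedes $b_1\cdots b_\ell$ if $a_i<b_i$ at the largest $i$ with $a_i\ne b_i$; reverse colexicographic order is its reverse. $\text{pre}_n(\alpha)$ is the length-$n$ prefix of $\alpha$. -}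

module Defs where

open import Data.Bool using (Bool; true; false; not)
open import Data.Nat using (ℕ; zero; suc; _<_)
open import Data.Fin using (Fin; toℕ)
open import Data.Vec using (Vec; []; _∷_; _∷ʳ_; lookup; map; _++_; take)
open import Data.Product using (Σ; _×_; ∃-syntax)
open import Data.Sum using (_⊎_)
open import Relation.Binary.PropositionalEquality using (_≡_)
open import Relation.Nullary using (¬_)

-- Binary strings of length m; bit 0 = false, bit 1 = true (so false < true).
BStr : ℕ → Set
BStr m = Vec Bool m

compl : ∀ {m} → BStr m → BStr m
compl = map not

_<lex_ : ∀ {m} → BStr m → BStr m → Set
_<lex_ {m} a b = ∃[ i ] (lookup a i ≡ false × lookup b i ≡ true ×
                  (∀ (j : Fin m) → toℕ j < toℕ i → lookup a j ≡ lookup b j))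

_≤lex_ : ∀ {m} → BStr m → BStr m → Set
a ≤lex b = a ≡ b ⊎ a <lex b

_<colex_ : ∀ {m} → BStr m → BStr m → Set
_<colex_ {m} a b = ∃[ i ] (lookup a i ≡ false × lookup b i ≡ true ×
                    (∀ (j : Fin m) → toℕ i < toℕ j → lookup a j ≡ lookup b j))

rot1 : ∀ {m} → BStr m → BStr m
rot1 [] = []
rot1 (x ∷ xs) = xs ∷ʳ x

rot : ∀ {m} → ℕ → BStr m → BStr m
rot zero s = s
rot (suc k) s = rot1 (rot k s)

IsNecklace : ∀ {m} → BStr m → Set
IsNecklace s = ∀ (k : ℕ) → s ≤lex rot k s

IsCoNecklace : ∀ {n} → BStr n → Set
IsCoNecklace α = IsNecklace (α ++ compl α)

InCoN : (n : ℕ) → BStr (n Data.Nat.+ n) → Set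
InCoN n γ = Σ (BStr n) (λ α → IsCoNecklace α × γ ≡ α ++ compl α)

-- α immediately precedes α' in the listing of coN(n) in reverse colex order
-- (reverse colex: γ precedes δ iff δ <colex γ)
ConsecRevColex : (n : ℕ) → BStr (n Data.Nat.+ n) → BStr (n Data.Nat.+ n) → Set
ConsecRevColex n α α' =
  InCoN n α × InCoN n α' × (α' <colex α) ×
  (∀ γ → InCoN n γ → ¬ ((α' <colex γ) × (γ <colex α)))

pre : ∀ n {k} → BStr (n Data.Nat.+ k) → BStr n
pre n s = take n s

module Submission where

-- Every member of coN(n) has the shape  x ++ compl x.  The
-- listing is in reverse colex order, so the successor α' = b ++ compl b of
-- α = a ++ compl a satisfies  α' <colex α  (this is the only hypothesis used).
-- The largest position where two strings of shape  x ++ compl x  differ lies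
-- in the second half, since there position n + j differs iff position j
-- does.  Hence comparing them in colex order amounts to comparing the
-- complemented halves, and complementation reverses colex order: from
-- compl b <colex compl a we get a <colex b, i.e. pre n α <colex pre n α'.

open import Defs
open import Data.Nat using (ℕ; _≥_; _<_)
open import Data.Nat.Properties using (<-≤-trans; m≤m+n; +-monoʳ-<)
open import Data.Bool using (true; false; not)
open import Data.Bool.Properties using (not-injective)
open import Data.Fin using (Fin; toℕ; splitAt; _↑ˡ_; _↑ʳ_)
open import Data.Fin.Properties using (toℕ-↑ˡ; toℕ-↑ʳ; splitAt⁻¹-↑ˡ; splitAt⁻¹-↑ʳ; toℕ<n)
open import Data.Vec using (Vec; []; _∷_; _++_; lookup; take; tabulate)
open import Data.Vec.Properties using (lookup-++ˡ; lookup-++ʳ; lookup-map; tabulate∘lookup; tabulate-cong)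
open import Data.Product using (_,_; _×_)
open import Data.Sum using (_⊎_; inj₁; inj₂)
open import Data.Empty using (⊥-elim)
open import Relation.Nullary using (¬_)
open import Relation.Binary.PropositionalEquality
  using (_≡_; refl; sym; trans; cong; subst₂; module ≡-Reasoning)

take-++ : ∀ {A : Set} {m k} (u : Vec A m) (v : Vec A k) → take m (u ++ v) ≡ u
take-++ []      v = refl
take-++ (x ∷ u) v = cong (x ∷_) (take-++ u v)

lookup-ext : ∀ {A : Set} {m} (u v : Vec A m) → (∀ i → lookup u i ≡ lookup v i) → u ≡ v
lookup-ext u v same = begin
  u                   ≡⟨ sym (tabulate∘lookup u) ⟩
  tabulate (lookup u) ≡⟨ tabulate-cong same ⟩
  tabulate (lookup v) ≡⟨ tabulate∘lookup v ⟩
  v                   ∎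
  where open ≡-Reasoning

compl-injective : ∀ {m} (u v : BStr m) → compl u ≡ compl v → u ≡ v
compl-injective u v eq = lookup-ext u v λ i → not-injective (begin
  not (lookup u i)     ≡⟨ sym (lookup-map i not u) ⟩
  lookup (compl u) i   ≡⟨ cong (λ w → lookup w i) eq ⟩
  lookup (compl v) i   ≡⟨ lookup-map i not v ⟩
  not (lookup v i)     ∎)
  where open ≡-Reasoning

colex-irrefl : ∀ {m} (u : BStr m) → ¬ (u <colex u)
colex-irrefl u (i , ui≡false , ui≡true , _) with trans (sym ui≡false) ui≡true
... | ()

compl-reverses-colex : ∀ {m} (u v : BStr m) → compl u <colex compl v → v <colex u
compl-reverses-colex u v (i , ūi , v̄i , above) =
  i , flip (trans (sym (lookup-map i not v)) v̄i) , flip (trans (sym (lookup-map i not u)) ūi) ,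
  λ j i<j → sym (not-injective (unflip j (above j i<j)))
  where
    flip : ∀ {x b} → not x ≡ b → x ≡ not b
    flip {false} refl = refl
    flip {true}  refl = refl
    unflip : ∀ j → lookup (compl u) j ≡ lookup (compl v) j → not (lookup u j) ≡ not (lookup v j)
    unflip j eq = trans (sym (lookup-map j not u)) (trans eq (lookup-map j not v))

colex-++ : ∀ {m k} (u u' : BStr m) (v v' : BStr k) →
  (u ++ v) <colex (u' ++ v') → (v <colex v') ⊎ (v ≡ v')
colex-++ {m} {k} u u' v v' (i , lo , hi , above) with splitAt m i in split
... | inj₂ j rewrite sym (splitAt⁻¹-↑ʳ split) =
  inj₁ (j , trans (sym (lookup-++ʳ u v j)) lo , trans (sym (lookup-++ʳ u' v' j)) hi ,
        λ l j<l → right-agrees l (above (m ↑ʳ l) (shift j l j<l)))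
  where
    shift : ∀ j l → toℕ j < toℕ l → toℕ (m ↑ʳ j) < toℕ (m ↑ʳ l)
    shift j l j<l = subst₂ _<_ (sym (toℕ-↑ʳ m j)) (sym (toℕ-↑ʳ m l)) (+-monoʳ-< m j<l)
    right-agrees : ∀ l → lookup (u ++ v) (m ↑ʳ l) ≡ lookup (u' ++ v') (m ↑ʳ l) → lookup v l ≡ lookup v' l
    right-agrees l eq = trans (sym (lookup-++ʳ u v l)) (trans eq (lookup-++ʳ u' v' l))
... | inj₁ j rewrite sym (splitAt⁻¹-↑ˡ split) =
  inj₂ (lookup-ext v v' λ l → trans (sym (lookup-++ʳ u v l))
                                (trans (above (m ↑ʳ l) (left<right l)) (lookup-++ʳ u' v' l)))
  where
    left<right : ∀ l → toℕ (j ↑ˡ k) < toℕ (m ↑ʳ l)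
    left<right l = subst₂ _<_ (sym (toℕ-↑ˡ j k)) (sym (toℕ-↑ʳ m l))
                          (<-≤-trans (toℕ<n j) (m≤m+n m (toℕ l)))

-- For strings of shape  x ++ compl x, colex order reverses on the halves:
-- the right halves must differ, and complementation reverses their order.
co-colex-reverses : ∀ {n} (a b : BStr n) → (b ++ compl b) <colex (a ++ compl a) → a <colex b
co-colex-reverses a b lt with colex-++ b a (compl b) (compl a) lt
... | inj₁ compl-lt = compl-reverses-colex b a compl-lt
... | inj₂ compl-eq with compl-injective b a compl-eq
...   | refl = ⊥-elim (colex-irrefl (b ++ compl b) lt)

lemma1 : (n : ℕ) → n ≥ 1 → (α α' : BStr (n Data.Nat.+ n)) →
    ConsecRevColex n α α' → pre n α <colex pre n α'
lemma1 n _ .(a ++ compl a) .(b ++ compl b) ((a , _ , refl) , (b , _ , refl) , α'<α , _)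
  rewrite take-++ a (compl a) | take-++ b (compl b) = co-colex-reverses a b α'<α
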